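{- Let $n\ge 2$ and $Q_n=\langle a,b\mid a^{2n}=e,\ a^n=b^2,\ ab=ba^{ -1}\rangle$ be the dicyclic group of order $4n$. Then $\delta(\mathcal{G}(Q_n))=3$. Moreover, for every $0\le i\le n-1$, both $E[a^ib,\{e,a^n,a^{n+i}b\}]$ and $E[a^{n+i}b,\{e,a^n,a^ib\}]$ are minimum disconnecting sets of $\mathcal{G}(Q_n)$.
   Context: The power graph $\mathcal{G}(G)$ of a group $G$ has vertex set $G$, distinct $u,v$ adjacent iff one is a positive integer power of the other; $\delta$ denotes minimum degree. $E[x,B]$ is the set of edges with one end $x$ and the other in $B$. A disconnecting set is a set of edges whose removal increases the number of components; a minimum disconnecting set is one of least cardinality. -}

module Defs where

open import Data.Nat using (ℕ; zero; suc; _+_; _∸_; _≤_; NonZero)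
open import Data.Nat.DivMod using (_mod_)
open import Data.Fin using (Fin; toℕ)
open import Data.Bool using (Bool; true; false)
open import Data.Product using (Σ; ∃; _×_; _,_)
open import Data.Sum using (_⊎_)
open import Data.List using (List; length)
open import Data.List.Membership.Propositional using (_∈_)
open import Data.List.Relation.Unary.Unique.Propositional using (Unique)
open import Data.List.Relation.Unary.All using (All)
open import Data.List.Relation.Unary.AllPairs using (AllPairs)
open import Relation.Binary.PropositionalEquality using (_≡_; _≢_)
open import Relation.Binary.Construct.Closure.ReflexiveTransitive using (Star)
open import Relation.Nullary using (¬_)

module Graph {V : Set} (Adj : V → V → Set) where

  HasDegree : V → ℕ → Set
  HasDegree v d = Σ (List V) λ L →
    Unique L × length L ≡ d × (∀ u → (u ∈ L → Adj v u) × (Adj v u → u ∈ L))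

  MinDegree : ℕ → Set
  MinDegree d = (∀ v k → HasDegree v k → d ≤ k) × ∃ λ v → HasDegree v d

  -- sets of edges, given as a relation on ordered pairs of vertices;
  -- F u v or F v u means the (unordered) edge {u,v} belongs to F
  EdgeSet : Set₁
  EdgeSet = V → V → Set

  IsEdgeSet : EdgeSet → Set
  IsEdgeSet F = ∀ u v → F u v → Adj u v

  SameEdge : V × V → V × V → Set
  SameEdge (u , v) (u' , v') = (u ≡ u' × v ≡ v') ⊎ (u ≡ v' × v ≡ u')

  InF : EdgeSet → V × V → Set
  InF F (u , v) = F u v

  EdgeCount : EdgeSet → ℕ → Set
  EdgeCount F d = Σ (List (V × V)) λ L →
    length L ≡ d × All (InF F) L × AllPairs (λ p q → ¬ SameEdge p q) L ×
    (∀ u v → F u v → ((u , v) ∈ L ⊎ (v , u) ∈ L))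

  Remove : EdgeSet → V → V → Set
  Remove F u v = Adj u v × ¬ F u v × ¬ F v u

  -- removing F increases the number of components, i.e. some pair of
  -- vertices connected in G is no longer connected in G - F
  Disconnecting : EdgeSet → Set
  Disconnecting F = ∃ λ u → ∃ λ v → Star Adj u v × ¬ Star (Remove F) u v

  MinimumDisconnecting : EdgeSet → Set₁
  MinimumDisconnecting F =
    IsEdgeSet F × Disconnecting F ×
    ∃ λ d → EdgeCount F d ×
      (∀ F' d' → IsEdgeSet F' → Disconnecting F' → EdgeCount F' d' → d ≤ d')

  E[_,_] : V → (V → Set) → EdgeSet
  E[ x , B ] u v = ((u ≡ x × B v) ⊎ (v ≡ x × B u)) × Adj u v

module PowerGraph {V : Set} (e : V) (_∙_ : V → V → V) where

  pow : V → ℕ → V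
  pow x zero = e
  pow x (suc k) = x ∙ pow x k

  PAdj : V → V → Set
  PAdj u v = u ≢ v × ∃ λ k → 1 ≤ k × (v ≡ pow u k ⊎ u ≡ pow v k)

-- The dicyclic group Q_n = ⟨a,b | a^{2n}=e, a^n=b^2, ab=ba^{-1}⟩ of order 4n,
-- realised concretely: (k , s) stands for a^k b^s, k ∈ Z/2n, s ∈ {0,1}.

instance
  nz-double : ∀ {n} → .{{NonZero n}} → NonZero (n + n)
  nz-double {suc n} = _

Q : ℕ → Set
Q n = Fin (n + n) × Bool

module Dicyclic (n : ℕ) .{{_ : NonZero n}} where

  md : ℕ → Fin (n + n)
  md k = k mod (n + n)

  e : Q n
  e = (md 0 , false)

  a : Q n
  a = (md 1 , false)

  b : Q n
  b = (md 0 , true)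

  -- a^i a^j = a^{i+j},  a^i a^j b = a^{i+j} b,
  -- a^i b a^j = a^{i-j} b,  a^i b a^j b = a^{i-j+n}
  _∙_ : Q n → Q n → Q n
  (i , false) ∙ (j , false) = (md (toℕ i + toℕ j) , false)
  (i , false) ∙ (j , true)  = (md (toℕ i + toℕ j) , true)
  (i , true)  ∙ (j , false) = (md (toℕ i + ((n + n) ∸ toℕ j)) , true)
  (i , true)  ∙ (j , true)  = (md (toℕ i + ((n + n) ∸ toℕ j) + n) , false)

  open PowerGraph e _∙_ public
  open Graph PAdj public

-- Every v ≢ e is joined to e by three edge-disjoint paths: the edge
-- v e and two paths v w₁ e, v w₂ e (a "fan").  For a rotation the middle
-- vertices are two of the generators a, a⁻¹ and the element aⁿ; for a
-- reflection a^x b they are aⁿ = (a^x b)² and a^{x+n} b = (a^x b)³.  Fans give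
-- degree ≥ 3 everywhere, and they show that removing at most two edges keeps
-- the graph connected (two edges cannot cut three disjoint paths), so every
-- disconnecting set has at least three edges.  Finally a reflection is
-- adjacent exactly to its powers e, aⁿ, a^{x+n} b, so cutting its three
-- edges isolates it; this gives both the vertex of degree 3 and the
-- minimum disconnecting sets.
module Submission where

open import Defs
open import Data.Nat using (ℕ; zero; suc; _+_; _*_; _∸_; _≤_; _<_; NonZero; z≤n; s≤s; _≤?_; >-nonZero⁻¹; ≢-nonZero⁻¹)
open import Data.Nat.Properties using (≤-pred; ≰⇒>; <⇒≤; <⇒≢; n<1+n; ≤-trans; <-trans; m≤n+m; *-mono-≤; *-comm; *-identityʳ; m∸n+n≡m; m≤m+n; m<m+n; +-comm; +-assoc; +-identityʳ)
open import Data.Nat.Tactic.RingSolver using (solve-∀)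
open import Data.Nat.DivMod using (_%_; m%n%n≡m%n; m<n⇒m%n≡m; %-distribˡ-+; [m+kn]%n≡m%n; [m+n]%n≡m%n)
open import Data.Fin using (Fin; toℕ)
import Data.Fin.Properties as Fin
open import Data.Fin.Properties using (toℕ-fromℕ<; toℕ-injective; toℕ<n)
open import Data.Bool using (true; false)
import Data.Bool.Properties as Bool
open import Data.Product using (∃; _×_; _,_; proj₁; proj₂)
open import Data.Product.Properties using (≡-dec)
open import Data.Sum using (_⊎_; inj₁; inj₂; [_,_]; swap)
open import Data.Empty using (⊥-elim)
open import Data.List using (List; []; _∷_; length)
open import Data.List.Membership.Propositional using (_∈_)
open import Data.List.Relation.Unary.Any using (here; there)
import Data.List.Membership.DecPropositional as DecMembership
import Data.List.Relation.Unary.All as All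
import Data.List.Relation.Unary.AllPairs as AllPairs
open import Relation.Binary.Definitions using (DecidableEquality)
open import Relation.Binary.PropositionalEquality using (_≡_; _≢_; refl; sym; trans; cong; cong₂; subst; ≢-sym; module ≡-Reasoning)
open import Relation.Binary.Construct.Closure.ReflexiveTransitive using (Star; ε; _◅_; _◅◅_; reverse)
open import Relation.Nullary using (¬_; Dec; yes; no)
open import Relation.Nullary.Decidable using (_⊎-dec_)

pigeonhole₃ : ∀ {A : Set} {L : List A} {x y z : A} → length L ≤ 2 →
  x ∈ L → y ∈ L → z ∈ L → x ≡ y ⊎ x ≡ z ⊎ y ≡ z
pigeonhole₃ {L = _ ∷ _ ∷ _ ∷ _} (s≤s (s≤s ())) _ _ _
pigeonhole₃ _ (here refl) (here refl) _ = inj₁ refl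
pigeonhole₃ _ (here refl) (there _) (here refl) = inj₂ (inj₁ refl)
pigeonhole₃ _ (there _) (here refl) (here refl) = inj₂ (inj₂ refl)
pigeonhole₃ _ (there (here refl)) (there (here refl)) _ = inj₁ refl
pigeonhole₃ _ (there (here refl)) (here refl) (there (here refl)) = inj₂ (inj₁ refl)
pigeonhole₃ _ (here refl) (there (here refl)) (there (here refl)) = inj₂ (inj₂ refl)

module ThreeFans {V : Set} (_≟_ : DecidableEquality V) (Adj : V → V → Set)
  (Adj-sym : ∀ {u v} → Adj u v → Adj v u) (Adj-irrefl : ∀ {u v} → Adj u v → u ≢ v) where

  open Graph Adj
  open DecMembership (≡-dec _≟_ _≟_) using (_∈?_)

  three-neighbours⇒3≤degree : ∀ {v k x y z} → HasDegree v k →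
    Adj v x → Adj v y → Adj v z → x ≢ y → x ≢ z → y ≢ z → 3 ≤ k
  three-neighbours⇒3≤degree {k = k} (L , _ , len , nbrs) vx vy vz x≢y x≢z y≢z with 3 ≤? k
  ... | yes 3≤k = 3≤k
  ... | no 3≰k = ⊥-elim ([ x≢y , [ x≢z , y≢z ] ]
          (pigeonhole₃ (subst (_≤ 2) (sym len) (≤-pred (≰⇒> 3≰k)))
            (proj₂ (nbrs _) vx) (proj₂ (nbrs _) vy) (proj₂ (nbrs _) vz)))

  -- A fan from v to r: the edge v r and two paths v w₁ r, v w₂ r with
  -- w₁ ≢ w₂.  By irreflexivity these three paths are edge-disjoint.
  record Fan (r v : V) : Set where
    field
      w₁ w₂ : V
      v-r : Adj v r
      v-w₁ : Adj v w₁
      w₁-r : Adj w₁ r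
      v-w₂ : Adj v w₂
      w₂-r : Adj w₂ r
      w₁≢w₂ : w₁ ≢ w₂

  Touches : V → V × V → Set
  Touches x (u , v) = x ≡ u ⊎ x ≡ v

  apart : ∀ {x p q} → Touches x p → ¬ Touches x q → ¬ SameEdge p q
  apart t ¬t (inj₁ (refl , refl)) = ¬t t
  apart (inj₁ refl) ¬t (inj₂ (refl , refl)) = ¬t (inj₂ refl)
  apart (inj₂ refl) ¬t (inj₂ (refl , refl)) = ¬t (inj₁ refl)

  touches-middle : ∀ {p u w z} → p ≡ (u , w) ⊎ p ≡ (w , z) → Touches w p
  touches-middle (inj₁ refl) = inj₂ refl
  touches-middle (inj₂ refl) = inj₁ refl

  avoids : ∀ {p u w z x} → x ≢ u → x ≢ w → x ≢ z → p ≡ (u , w) ⊎ p ≡ (w , z) → ¬ Touches x p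
  avoids x≢u x≢w x≢z (inj₁ refl) = [ x≢u , x≢w ]
  avoids x≢u x≢w x≢z (inj₂ refl) = [ x≢w , x≢z ]

  same-entry : ∀ {p q y} → SameEdge p y → SameEdge q y → SameEdge p q
  same-entry (inj₁ (refl , refl)) (inj₁ (refl , refl)) = inj₁ (refl , refl)
  same-entry (inj₁ (refl , refl)) (inj₂ (refl , refl)) = inj₂ (refl , refl)
  same-entry (inj₂ (refl , refl)) (inj₁ (refl , refl)) = inj₂ (refl , refl)
  same-entry (inj₂ (refl , refl)) (inj₂ (refl , refl)) = inj₁ (refl , refl)

  Remove-sym : ∀ {F u v} → Remove F u v → Remove F v u
  Remove-sym (uv , ¬Fuv , ¬Fvu) = Adj-sym uv , ¬Fvu , ¬Fuv

  module Removing (F : EdgeSet) (L : List (V × V))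
                  (covers : ∀ u v → F u v → (u , v) ∈ L ⊎ (v , u) ∈ L) where

    Listed : V × V → Set
    Listed (u , v) = (u , v) ∈ L ⊎ (v , u) ∈ L

    listed? : ∀ p → Dec (Listed p)
    listed? (u , v) = ((u , v) ∈? L) ⊎-dec ((v , u) ∈? L)

    survives : ∀ {u v} → Adj u v → ¬ Listed (u , v) → Remove F u v
    survives uv ¬l = uv , (λ f → ¬l (covers _ _ f)) , (λ f → ¬l (swap (covers _ _ f)))

    at-most-two : ∀ {p q s} → length L ≤ 2 → Listed p → Listed q → Listed s →
      SameEdge p q ⊎ SameEdge p s ⊎ SameEdge q s
    at-most-two short lp lq ls with entry lp | entry lq | entry ls
      where
        entry : ∀ {p} → Listed p → ∃ λ y → y ∈ L × SameEdge p y
        entry (inj₁ y∈L) = _ , y∈L , inj₁ (refl , refl)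
        entry (inj₂ y∈L) = _ , y∈L , inj₂ (refl , refl)
    ... | y₁ , y₁∈L , p~y₁ | y₂ , y₂∈L , q~y₂ | y₃ , y₃∈L , s~y₃
      with pigeonhole₃ short y₁∈L y₂∈L y₃∈L
    ... | inj₁ refl = inj₁ (same-entry p~y₁ q~y₂)
    ... | inj₂ (inj₁ refl) = inj₂ (inj₁ (same-entry p~y₁ s~y₃))
    ... | inj₂ (inj₂ refl) = inj₂ (inj₂ (same-entry q~y₂ s~y₃))

    detour : ∀ {u w z} → Adj u w → Adj w z →
      Star (Remove F) u z ⊎ ∃ λ p → Listed p × (p ≡ (u , w) ⊎ p ≡ (w , z))
    detour {u} {w} {z} uw wz with listed? (u , w) | listed? (w , z)
    ... | yes l | _ = inj₂ (_ , l , inj₁ refl)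
    ... | no _ | yes l = inj₂ (_ , l , inj₂ refl)
    ... | no ¬l₁ | no ¬l₂ = inj₁ (survives uw ¬l₁ ◅ survives wz ¬l₂ ◅ ε)

    fan-survives : ∀ {r v} → length L ≤ 2 → Fan r v → Star (Remove F) v r
    fan-survives {r} {v} short fan
      with listed? (v , r) | detour v-w₁ w₁-r | detour v-w₂ w₂-r
      where open Fan fan
    ... | no ¬l | _ | _ = survives (Fan.v-r fan) ¬l ◅ ε
    ... | yes _ | inj₁ path | _ = path
    ... | yes _ | inj₂ _ | inj₁ path = path
    ... | yes l₀ | inj₂ (p₁ , l₁ , on₁) | inj₂ (p₂ , l₂ , on₂) =
      ⊥-elim ([ p₁≉p₂ , [ p₁≉vr , p₂≉vr ] ] (at-most-two short l₁ l₂ l₀))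
      where
        open Fan fan
        w₁≢v : w₁ ≢ v
        w₁≢v = ≢-sym (Adj-irrefl v-w₁)
        w₂≢v : w₂ ≢ v
        w₂≢v = ≢-sym (Adj-irrefl v-w₂)
        p₁≉p₂ : ¬ SameEdge p₁ p₂
        p₁≉p₂ = apart (touches-middle on₁) (avoids w₁≢v w₁≢w₂ (Adj-irrefl w₁-r) on₂)
        p₁≉vr : ¬ SameEdge p₁ (v , r)
        p₁≉vr = apart (touches-middle on₁) [ w₁≢v , Adj-irrefl w₁-r ]
        p₂≉vr : ¬ SameEdge p₂ (v , r)
        p₂≉vr = apart (touches-middle on₂) [ w₂≢v , Adj-irrefl w₂-r ]

  record ThreeNeighbours (x y₁ y₂ y₃ : V) : Set where
    field
      adj₁ : Adj x y₁
      adj₂ : Adj x y₂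
      adj₃ : Adj x y₃
      y₁≢y₂ : y₁ ≢ y₂
      y₁≢y₃ : y₁ ≢ y₃
      y₂≢y₃ : y₂ ≢ y₃
      only : ∀ u → Adj x u → u ≡ y₁ ⊎ u ≡ y₂ ⊎ u ≡ y₃

  Among : V → V → V → V → Set
  Among y₁ y₂ y₃ v = v ≡ y₁ ⊎ v ≡ y₂ ⊎ v ≡ y₃

  three-neighbours⇒degree3 : ∀ {x y₁ y₂ y₃} → ThreeNeighbours x y₁ y₂ y₃ → HasDegree x 3
  three-neighbours⇒degree3 {x} {y₁} {y₂} {y₃} nb =
    y₁ ∷ y₂ ∷ y₃ ∷ [] ,
    (y₁≢y₂ All.∷ y₁≢y₃ All.∷ All.[]) AllPairs.∷ (y₂≢y₃ All.∷ All.[]) AllPairs.∷ All.[] AllPairs.∷ AllPairs.[] ,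
    refl , λ u → listed⇒adj u , adj⇒listed u
    where
      open ThreeNeighbours nb
      listed⇒adj : ∀ u → u ∈ y₁ ∷ y₂ ∷ y₃ ∷ [] → Adj x u
      listed⇒adj _ (here refl) = adj₁
      listed⇒adj _ (there (here refl)) = adj₂
      listed⇒adj _ (there (there (here refl))) = adj₃
      adj⇒listed : ∀ u → Adj x u → u ∈ y₁ ∷ y₂ ∷ y₃ ∷ []
      adj⇒listed u xu with only u xu
      ... | inj₁ eq = here eq
      ... | inj₂ (inj₁ eq) = there (here eq)
      ... | inj₂ (inj₂ eq) = there (there (here eq))

  isolating-cut : ∀ {x y₁ y₂ y₃} → ThreeNeighbours x y₁ y₂ y₃ →
    IsEdgeSet E[ x , Among y₁ y₂ y₃ ] × Disconnecting E[ x , Among y₁ y₂ y₃ ] ×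
    EdgeCount E[ x , Among y₁ y₂ y₃ ] 3
  isolating-cut {x} {y₁} {y₂} {y₃} nb =
    (λ _ _ → proj₂) ,
    (x , y₁ , adj₁ ◅ ε , λ path → Adj-irrefl adj₁ (stranded path)) ,
    (x , y₁) ∷ (x , y₂) ∷ (x , y₃) ∷ [] , refl ,
    (inj₁ (refl , inj₁ refl) , adj₁) All.∷ (inj₁ (refl , inj₂ (inj₁ refl)) , adj₂) All.∷
      (inj₁ (refl , inj₂ (inj₂ refl)) , adj₃) All.∷ All.[] ,
    (spokes-differ y₁≢y₂ adj₂ All.∷ spokes-differ y₁≢y₃ adj₃ All.∷ All.[]) AllPairs.∷
      (spokes-differ y₂≢y₃ adj₃ All.∷ All.[]) AllPairs.∷ All.[] AllPairs.∷ AllPairs.[] ,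
    listed
    where
      open ThreeNeighbours nb
      F : EdgeSet
      F = E[ x , Among y₁ y₂ y₃ ]
      stranded : ∀ {w} → Star (Remove F) x w → x ≡ w
      stranded ε = refl
      stranded ((xu , ¬Fxu , _) ◅ _) = ⊥-elim (¬Fxu (inj₁ (refl , only _ xu) , xu))
      spokes-differ : ∀ {y y'} → y ≢ y' → Adj x y' → ¬ SameEdge (x , y) (x , y')
      spokes-differ y≢y' _ (inj₁ (_ , y≡y')) = y≢y' y≡y'
      spokes-differ _ xy' (inj₂ (x≡y' , _)) = Adj-irrefl xy' x≡y'
      listed : ∀ u v → F u v → (u , v) ∈ (x , y₁) ∷ (x , y₂) ∷ (x , y₃) ∷ [] ⊎
                               (v , u) ∈ (x , y₁) ∷ (x , y₂) ∷ (x , y₃) ∷ []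
      listed _ _ (inj₁ (refl , inj₁ refl) , _) = inj₁ (here refl)
      listed _ _ (inj₁ (refl , inj₂ (inj₁ refl)) , _) = inj₁ (there (here refl))
      listed _ _ (inj₁ (refl , inj₂ (inj₂ refl)) , _) = inj₁ (there (there (here refl)))
      listed _ _ (inj₂ (refl , inj₁ refl) , _) = inj₂ (here refl)
      listed _ _ (inj₂ (refl , inj₂ (inj₁ refl)) , _) = inj₂ (there (here refl))
      listed _ _ (inj₂ (refl , inj₂ (inj₂ refl)) , _) = inj₂ (there (there (here refl)))

  module Rooted (r : V) (fan : ∀ v → v ≢ r → Fan r v) where

    two-edges-keep-connected : ∀ F d → EdgeCount F d → d ≤ 2 → ∀ u v → Star (Remove F) u v
    two-edges-keep-connected F d (L , len , _ , _ , covers) d≤2 u v =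
      to-root u ◅◅ reverse (Remove-sym {F}) (to-root v)
      where
        to-root : ∀ w → Star (Remove F) w r
        to-root w with w ≟ r
        ... | yes refl = ε
        ... | no w≢r = Removing.fan-survives F L covers (subst (_≤ 2) (sym len) d≤2) (fan w w≢r)

    disconnecting⇒3≤size : ∀ F d → Disconnecting F → EdgeCount F d → 3 ≤ d
    disconnecting⇒3≤size F d (u , v , _ , cut) count with 3 ≤? d
    ... | yes 3≤d = 3≤d
    ... | no 3≰d = ⊥-elim (cut (two-edges-keep-connected F d count (≤-pred (≰⇒> 3≰d)) u v))

    -- Every vertex has degree at least 3; the root needs some other vertex x.
    3≤degree : ∀ {x} → x ≢ r → ∀ v k → HasDegree v k → 3 ≤ k
    3≤degree {x} x≢r v k deg with v ≟ r
    ... | yes refl = three-neighbours⇒3≤degree deg (Adj-sym v-r) (Adj-sym w₁-r) (Adj-sym w₂-r)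
                       (Adj-irrefl v-w₁) (Adj-irrefl v-w₂) w₁≢w₂
      where open Fan (fan x x≢r)
    ... | no v≢r = three-neighbours⇒3≤degree deg v-r v-w₁ v-w₂
                     (≢-sym (Adj-irrefl w₁-r)) (≢-sym (Adj-irrefl w₂-r)) w₁≢w₂
      where open Fan (fan v v≢r)

    isolating-cut-minimum : ∀ {x y₁ y₂ y₃} → ThreeNeighbours x y₁ y₂ y₃ →
      MinimumDisconnecting E[ x , Among y₁ y₂ y₃ ]
    isolating-cut-minimum nb with isolating-cut nb
    ... | edges , disconnecting , count =
      edges , disconnecting , 3 , count , λ F d _ → disconnecting⇒3≤size F d

module PowerGraphFacts {V : Set} (e : V) (_∙_ : V → V → V) where
  open PowerGraph e _∙_

  PAdj-sym : ∀ {u v} → PAdj u v → PAdj v u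
  PAdj-sym (u≢v , k , 1≤k , power) = ≢-sym u≢v , k , 1≤k , swap power

  PAdj-irrefl : ∀ {u v} → PAdj u v → u ≢ v
  PAdj-irrefl = proj₁

  power-adj : ∀ {u v} k → u ≢ v → 1 ≤ k → v ≡ pow u k → PAdj u v
  power-adj k u≢v 1≤k v≡uᵏ = u≢v , k , 1≤k , inj₁ v≡uᵏ

-- Arithmetic of Q_n in the normal forms  rot x = a^x  and  ref x = a^x b,
-- for natural exponents x read modulo m = 2n.
module DicyclicArithmetic (n : ℕ) .{{_ : NonZero n}} where
  open Dicyclic n
  open ≡-Reasoning

  m : ℕ
  m = n + n

  rot : ℕ → Q n
  rot x = (md x , false)

  ref : ℕ → Q n
  ref x = (md x , true)

  infix 4 _≋_
  _≋_ : ℕ → ℕ → Set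
  x ≋ y = md x ≡ md y

  toℕ-md : ∀ x → toℕ (md x) ≡ x % m
  toℕ-md x = toℕ-fromℕ< _

  %⇒≋ : ∀ {x y} → x % m ≡ y % m → x ≋ y
  %⇒≋ {x} {y} eq = toℕ-injective (trans (toℕ-md x) (trans eq (sym (toℕ-md y))))

  ≋⇒% : ∀ {x y} → x ≋ y → x % m ≡ y % m
  ≋⇒% {x} {y} eq = trans (sym (toℕ-md x)) (trans (cong toℕ eq) (toℕ-md y))

  ≋⇒≡ : ∀ {x y} → x < m → y < m → x ≋ y → x ≡ y
  ≋⇒≡ x<m y<m eq = trans (sym (m<n⇒m%n≡m x<m)) (trans (≋⇒% eq) (m<n⇒m%n≡m y<m))

  reduce : ∀ x → toℕ (md x) ≋ x
  reduce x = %⇒≋ (trans (cong (_% m) (toℕ-md x)) (m%n%n≡m%n x m))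

  md-toℕ : (j : Fin m) → md (toℕ j) ≡ j
  md-toℕ j = toℕ-injective (trans (toℕ-md (toℕ j)) (m<n⇒m%n≡m (toℕ<n j)))

  +-≋ : ∀ {x x' y y'} → x ≋ x' → y ≋ y' → x + y ≋ x' + y'
  +-≋ {x} {x'} {y} {y'} x≋x' y≋y' = %⇒≋ (begin
      (x + y) % m             ≡⟨ %-distribˡ-+ x y m ⟩
      (x % m + y % m) % m     ≡⟨ cong₂ (λ s t → (s + t) % m) (≋⇒% x≋x') (≋⇒% y≋y') ⟩
      (x' % m + y' % m) % m   ≡⟨ sym (%-distribˡ-+ x' y' m) ⟩
      (x' + y') % m           ∎)

  period : ∀ x k → x + k * m ≋ x
  period x k = %⇒≋ ([m+kn]%n≡m%n x k m)

  full-turn : ∀ x → x + m ≋ x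
  full-turn x = %⇒≋ ([m+n]%n≡m%n x m)

  opp : ℕ → ℕ
  opp y = m ∸ toℕ (md y)

  opp-inverse : ∀ y → opp y + y ≋ 0
  opp-inverse y = begin
    md (opp y + y)            ≡⟨ +-≋ refl (sym (reduce y)) ⟩
    md (opp y + toℕ (md y))   ≡⟨ cong md (m∸n+n≡m (<⇒≤ (toℕ<n (md y)))) ⟩
    md m                      ≡⟨ full-turn 0 ⟩
    md 0                      ∎

  cancel : ∀ x y → x + (opp y + y) ≋ x
  cancel x y = trans (+-≋ {x} refl (opp-inverse y)) (cong md (+-identityʳ x))

  +-cancelˡ-≋ : ∀ z {x y} → z + x ≋ z + y → x ≋ y
  +-cancelˡ-≋ z {x} {y} eq = begin
    md x                   ≡⟨ sym (cancel x z) ⟩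
    md (x + (opp z + z))   ≡⟨ cong md (regroup x) ⟩
    md (opp z + (z + x))   ≡⟨ +-≋ {opp z} refl eq ⟩
    md (opp z + (z + y))   ≡⟨ cong md (sym (regroup y)) ⟩
    md (y + (opp z + z))   ≡⟨ cancel y z ⟩
    md y                   ∎
    where
      regroup : ∀ w → w + (opp z + z) ≡ opp z + (z + w)
      regroup w = trans (+-comm w _) (+-assoc (opp z) z w)

  0<m : 0 < m
  0<m = ≤-trans (>-nonZero⁻¹ n) (m≤m+n n n)

  n<m : n < m
  n<m = m<m+n n (>-nonZero⁻¹ n)

  rot-rot : ∀ x y → rot x ∙ rot y ≡ rot (x + y)
  rot-rot x y = cong (_, false) (+-≋ (reduce x) (reduce y))

  rot-ref : ∀ x y → rot x ∙ ref y ≡ ref (x + y)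
  rot-ref x y = cong (_, true) (+-≋ (reduce x) (reduce y))

  ref-rot : ∀ x y → ref x ∙ rot y ≡ ref (x + opp y)
  ref-rot x y = cong (_, true) (+-≋ (reduce x) refl)

  ref-ref : ∀ x y → ref x ∙ ref y ≡ rot (x + opp y + n)
  ref-ref x y = cong (_, false) (+-≋ (+-≋ (reduce x) refl) refl)

  rot-form : (j : Fin m) → (j , false) ≡ rot (toℕ j)
  rot-form j = cong (_, false) (sym (md-toℕ j))

  ref-form : (j : Fin m) → (j , true) ≡ ref (toℕ j)
  ref-form j = cong (_, true) (sym (md-toℕ j))

  pow-rot : ∀ x k → pow (rot x) k ≡ rot (k * x)
  pow-rot x zero = refl
  pow-rot x (suc k) = trans (cong (rot x ∙_) (pow-rot x k)) (rot-rot x (k * x))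

  ref-unit : ∀ x → ref x ∙ e ≡ ref x
  ref-unit x = trans (ref-rot x 0)
    (cong (_, true) (trans (cong (λ t → md (x + t)) (sym (+-identityʳ (opp 0)))) (cancel x 0)))

  ref-square : ∀ x → ref x ∙ ref x ≡ rot n
  ref-square x = trans (ref-ref x x)
    (cong (_, false) (trans (cong md (regroup x (opp x) n)) (cancel n x)))
    where
      regroup : ∀ x o n → x + o + n ≡ n + (o + x)
      regroup = solve-∀

  ref-half-turn : ∀ x → ref x ∙ rot n ≡ ref (x + n)
  ref-half-turn x = trans (ref-rot x n) (cong (_, true) (begin
    md (x + opp n)                 ≡⟨ sym (full-turn (x + opp n)) ⟩
    md (x + opp n + (n + n))       ≡⟨ cong md (regroup x (opp n) n) ⟩
    md (x + n + (opp n + n))       ≡⟨ cancel (x + n) n ⟩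
    md (x + n)                     ∎))
    where
      regroup : ∀ x o n → x + o + (n + n) ≡ x + n + (o + n)
      regroup = solve-∀

  ref-partner : ∀ x → ref x ∙ ref (x + n) ≡ e
  ref-partner x = trans (ref-ref x (x + n))
    (cong (_, false) (trans (cong md (regroup x (opp (x + n)) n)) (cancel 0 (x + n))))
    where
      regroup : ∀ x o n → x + o + n ≡ 0 + (o + (x + n))
      regroup = solve-∀

  ref-pow₂ : ∀ x → pow (ref x) 2 ≡ rot n
  ref-pow₂ x = trans (cong (ref x ∙_) (ref-unit x)) (ref-square x)

  ref-pow₃ : ∀ x → pow (ref x) 3 ≡ ref (x + n)
  ref-pow₃ x = trans (cong (ref x ∙_) (ref-pow₂ x)) (ref-half-turn x)

  ref-pow₄ : ∀ x → pow (ref x) 4 ≡ e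
  ref-pow₄ x = trans (cong (ref x ∙_) (ref-pow₃ x)) (ref-partner x)

  Orbit : ℕ → Q n → Set
  Orbit x w = w ≡ e ⊎ w ≡ ref x ⊎ w ≡ rot n ⊎ w ≡ ref (x + n)

  ref-powers : ∀ x k → Orbit x (pow (ref x) k)
  ref-powers x zero = inj₁ refl
  ref-powers x (suc k) with ref-powers x k
  ... | inj₁ eq = inj₂ (inj₁ (trans (cong (ref x ∙_) eq) (ref-unit x)))
  ... | inj₂ (inj₁ eq) = inj₂ (inj₂ (inj₁ (trans (cong (ref x ∙_) eq) (ref-square x))))
  ... | inj₂ (inj₂ (inj₁ eq)) = inj₂ (inj₂ (inj₂ (trans (cong (ref x ∙_) eq) (ref-half-turn x))))
  ... | inj₂ (inj₂ (inj₂ eq)) = inj₁ (trans (cong (ref x ∙_) eq) (ref-partner x))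

  half-turn-twice : ∀ x → x + n + n ≋ x
  half-turn-twice x = trans (cong md (+-assoc x n n)) (full-turn x)

  ref≢partner : ∀ x → ref x ≢ ref (x + n)
  ref≢partner x eq = ≢-nonZero⁻¹ n (sym (≋⇒≡ 0<m n<m 0≋n))
    where
      0≋n : 0 ≋ n
      0≋n = +-cancelˡ-≋ x (trans (cong md (+-identityʳ x)) (cong proj₁ eq))

  partner-sym : ∀ x y → ref x ≡ ref (y + n) → ref y ≡ ref (x + n)
  partner-sym x y eq = cong (_, true) (sym (trans (+-≋ (cong proj₁ eq) refl) (half-turn-twice y)))

module DicyclicPowerGraph (q : ℕ) where
  n : ℕ
  n = suc (suc q)

  open Dicyclic n
  open DicyclicArithmetic n
  open PowerGraphFacts e _∙_
  open ≡-Reasoning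

  _≟Q_ : DecidableEquality (Q n)
  _≟Q_ = ≡-dec Fin._≟_ Bool._≟_

  open ThreeFans _≟Q_ PAdj PAdj-sym PAdj-irrefl public

  -- a⁻¹ = a^p with p = 2n - 1, so that m = suc p.
  p : ℕ
  p = suc (q + n)

  a⁻¹ aⁿ : Q n
  a⁻¹ = rot p
  aⁿ = rot n

  1<n : 1 < n
  1<n = s≤s (s≤s z≤n)

  n<p : n < p
  n<p = s≤s (m≤n+m n q)

  p<m : p < m
  p<m = n<1+n p

  rot-distinct : ∀ {x y} → x < y → y < m → rot x ≢ rot y
  rot-distinct x<y y<m eq = <⇒≢ x<y (≋⇒≡ (<-trans x<y y<m) y<m (cong proj₁ eq))

  -- The rotations e, a, aⁿ, a⁻¹ are pairwise distinct since 0 < 1 < n < p < m.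
  a≢e : a ≢ e
  a≢e = ≢-sym (rot-distinct (s≤s z≤n) (<-trans 1<n n<m))

  a⁻¹≢e : a⁻¹ ≢ e
  a⁻¹≢e = ≢-sym (rot-distinct (s≤s z≤n) p<m)

  aⁿ≢e : aⁿ ≢ e
  aⁿ≢e = ≢-sym (rot-distinct (s≤s z≤n) n<m)

  a≢a⁻¹ : a ≢ a⁻¹
  a≢a⁻¹ = rot-distinct (<-trans 1<n n<p) p<m

  a≢aⁿ : a ≢ aⁿ
  a≢aⁿ = rot-distinct 1<n n<m

  aⁿ≢a⁻¹ : aⁿ ≢ a⁻¹
  aⁿ≢a⁻¹ = rot-distinct n<p p<m

  -- Every element v ≢ e is adjacent to e, since v^{2n} = e.
  rotation-order : ∀ x → pow (rot x) m ≡ e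
  rotation-order x = trans (pow-rot x m) (cong (_, false) (trans (cong md (*-comm m x)) (period 0 x)))

  adj-e : ∀ v → v ≢ e → PAdj v e
  adj-e (j , false) v≢e = power-adj m v≢e (s≤s z≤n)
    (sym (trans (cong (λ w → pow w m) (rot-form j)) (rotation-order (toℕ j))))
  adj-e (j , true) v≢e = power-adj 4 v≢e (s≤s z≤n)
    (sym (trans (cong (λ w → pow w 4) (ref-form j)) (ref-pow₄ (toℕ j))))

  Generates : Q n → Set
  Generates g = ∀ x → ∃ λ k → 1 ≤ k × pow g k ≡ rot x

  generator-adj : ∀ {g} → Generates g → ∀ j → g ≢ (j , false) → PAdj g (j , false)
  generator-adj gen j g≢v with gen (toℕ j)
  ... | k , 1≤k , gᵏ≡v = power-adj k g≢v 1≤k (trans (rot-form j) (sym gᵏ≡v))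

  -- Shifting by m makes an exponent positive without changing its residue.
  1≤x+m : ∀ x → 1 ≤ x + m
  1≤x+m x = ≤-trans 0<m (m≤n+m m x)

  a-generates : Generates a
  a-generates x = x + m , 1≤x+m x , (begin
    pow a (x + m)        ≡⟨ pow-rot 1 (x + m) ⟩
    rot ((x + m) * 1)    ≡⟨ cong (λ t → rot t) (*-identityʳ (x + m)) ⟩
    rot (x + m)          ≡⟨ cong (_, false) (full-turn x) ⟩
    rot x                ∎)

  -- p² ≡ 1 (mod m), since m = p + 1.
  inverse-square : ∀ y → y * p * p ≋ y
  inverse-square y = begin
    md (y * p * p)                   ≡⟨ sym (period (y * p * p) (2 * y)) ⟩
    md (y * p * p + 2 * y * suc p)   ≡⟨ cong md (expand y p) ⟩
    md (y + y * suc p * suc p)       ≡⟨ period y (y * suc p) ⟩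
    md y                             ∎
    where
      expand : ∀ y p → y * p * p + 2 * y * suc p ≡ y + y * suc p * suc p
      expand = solve-∀

  a⁻¹-generates : Generates a⁻¹
  a⁻¹-generates x = (x + m) * p , *-mono-≤ (1≤x+m x) (s≤s z≤n) , (begin
    pow a⁻¹ ((x + m) * p)     ≡⟨ pow-rot p ((x + m) * p) ⟩
    rot ((x + m) * p * p)     ≡⟨ cong (_, false) (inverse-square (x + m)) ⟩
    rot (x + m)               ≡⟨ cong (_, false) (full-turn x) ⟩
    rot x                     ∎)

  rotation-fan : ∀ j → (j , false) ≢ e → Fan e (j , false)
  rotation-fan j v≢e with (j , false) ≟Q a | (j , false) ≟Q a⁻¹
  ... | yes refl | _ = record
    { w₁ = a⁻¹ ; w₂ = aⁿ ; v-r = adj-e a a≢e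
    ; v-w₁ = generator-adj a-generates _ a≢a⁻¹ ; w₁-r = adj-e a⁻¹ a⁻¹≢e
    ; v-w₂ = generator-adj a-generates _ a≢aⁿ ; w₂-r = adj-e aⁿ aⁿ≢e
    ; w₁≢w₂ = ≢-sym aⁿ≢a⁻¹ }
  ... | no _ | yes refl = record
    { w₁ = a ; w₂ = aⁿ ; v-r = adj-e a⁻¹ a⁻¹≢e
    ; v-w₁ = generator-adj a⁻¹-generates _ (≢-sym a≢a⁻¹) ; w₁-r = adj-e a a≢e
    ; v-w₂ = generator-adj a⁻¹-generates _ (≢-sym aⁿ≢a⁻¹) ; w₂-r = adj-e aⁿ aⁿ≢e
    ; w₁≢w₂ = a≢aⁿ }
  ... | no v≢a | no v≢a⁻¹ = record
    { w₁ = a ; w₂ = a⁻¹ ; v-r = adj-e _ v≢e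
    ; v-w₁ = PAdj-sym (generator-adj a-generates j (≢-sym v≢a)) ; w₁-r = adj-e a a≢e
    ; v-w₂ = PAdj-sym (generator-adj a⁻¹-generates j (≢-sym v≢a⁻¹)) ; w₂-r = adj-e a⁻¹ a⁻¹≢e
    ; w₁≢w₂ = a≢a⁻¹ }

  reflection-neighbours : ∀ x → ThreeNeighbours (ref x) e aⁿ (ref (x + n))
  reflection-neighbours x = record
    { adj₁ = power-adj 4 (λ ()) (s≤s z≤n) (sym (ref-pow₄ x))
    ; adj₂ = power-adj 2 (λ ()) (s≤s z≤n) (sym (ref-pow₂ x))
    ; adj₃ = power-adj 3 (ref≢partner x) (s≤s z≤n) (sym (ref-pow₃ x))
    ; y₁≢y₂ = rot-distinct (s≤s z≤n) n<m
    ; y₁≢y₃ = λ ()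
    ; y₂≢y₃ = λ ()
    ; only = only }
    where
      only : ∀ u → PAdj (ref x) u → u ≡ e ⊎ u ≡ aⁿ ⊎ u ≡ ref (x + n)
      only u (x≢u , k , _ , inj₁ u≡xᵏ) with ref-powers x k
      ... | inj₁ xᵏ≡e = inj₁ (trans u≡xᵏ xᵏ≡e)
      ... | inj₂ (inj₁ xᵏ≡x) = ⊥-elim (x≢u (sym (trans u≡xᵏ xᵏ≡x)))
      ... | inj₂ (inj₂ (inj₁ xᵏ≡aⁿ)) = inj₂ (inj₁ (trans u≡xᵏ xᵏ≡aⁿ))
      ... | inj₂ (inj₂ (inj₂ xᵏ≡x')) = inj₂ (inj₂ (trans u≡xᵏ xᵏ≡x'))
      -- a rotation has only rotations as powers
      only (j , false) (_ , k , _ , inj₂ x≡uᵏ)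
        with () ← cong proj₂ (trans x≡uᵏ (trans (cong (λ w → pow w k) (rot-form j)) (pow-rot (toℕ j) k)))
      -- a reflection u = a^y b has a^x b as a power only if a^x b = a^{y+n} b
      only (j , true) (x≢u , k , _ , inj₂ x≡uᵏ)
        with ref-powers (toℕ j) k | trans x≡uᵏ (cong (λ w → pow w k) (ref-form j))
      ... | inj₁ uᵏ≡e | x≡yᵏ with () ← cong proj₂ (trans x≡yᵏ uᵏ≡e)
      ... | inj₂ (inj₁ uᵏ≡y) | x≡yᵏ = ⊥-elim (x≢u (trans x≡yᵏ (trans uᵏ≡y (sym (ref-form j)))))
      ... | inj₂ (inj₂ (inj₁ uᵏ≡aⁿ)) | x≡yᵏ with () ← cong proj₂ (trans x≡yᵏ uᵏ≡aⁿ)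
      ... | inj₂ (inj₂ (inj₂ uᵏ≡y')) | x≡yᵏ =
        inj₂ (inj₂ (trans (ref-form j) (partner-sym x (toℕ j) (trans x≡yᵏ uᵏ≡y'))))

  reflection-fan : ∀ x → Fan e (ref x)
  reflection-fan x = record
    { w₁ = aⁿ ; w₂ = ref (x + n) ; v-r = adj₁ ; v-w₁ = adj₂ ; w₁-r = adj-e aⁿ aⁿ≢e
    ; v-w₂ = adj₃ ; w₂-r = ThreeNeighbours.adj₁ (reflection-neighbours (x + n)) ; w₁≢w₂ = y₂≢y₃ }
    where open ThreeNeighbours (reflection-neighbours x)

  fan : ∀ v → v ≢ e → Fan e v
  fan (j , false) v≢e = rotation-fan j v≢e
  fan (j , true) _ = subst (Fan e) (sym (ref-form j)) (reflection-fan (toℕ j))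

  open Rooted e fan public

  aᵏ≡rot : ∀ k → pow a k ≡ rot k
  aᵏ≡rot k = trans (pow-rot 1 k) (cong (λ t → rot t) (*-identityʳ k))

  aᵏb≡ref : ∀ k → pow a k ∙ b ≡ ref k
  aᵏb≡ref k = trans (cong (_∙ b) (aᵏ≡rot k)) (trans (rot-ref k 0) (cong (λ t → ref t) (+-identityʳ k)))

  relabel : ∀ {x x' y y' z z'} → x ≡ x' → y ≡ y' → z ≡ z' →
    ThreeNeighbours x e y z → ThreeNeighbours x' e y' z'
  relabel refl refl refl nb = nb

  neighbours-aⁱb : ∀ i → ThreeNeighbours (pow a i ∙ b) e (pow a n) (pow a (n + i) ∙ b)
  neighbours-aⁱb i =
    relabel (sym (aᵏb≡ref i)) (sym (aᵏ≡rot n))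
      (sym (trans (aᵏb≡ref (n + i)) (cong (λ t → ref t) (+-comm n i))))
      (reflection-neighbours i)

  neighbours-aⁿ⁺ⁱb : ∀ i → ThreeNeighbours (pow a (n + i) ∙ b) e (pow a n) (pow a i ∙ b)
  neighbours-aⁿ⁺ⁱb i =
    relabel (sym (aᵏb≡ref (n + i))) (sym (aᵏ≡rot n))
      (trans (cong (_, true) full-turn′) (sym (aᵏb≡ref i)))
      (reflection-neighbours (n + i))
    where
      full-turn′ : n + i + n ≋ i
      full-turn′ = trans (cong (λ t → md (t + n)) (+-comm n i)) (half-turn-twice i)

theorem5p4 : (n : ℕ) .{{_ : NonZero n}} → 2 ≤ n →
    let open Dicyclic n in
    MinDegree 3 ×
    (∀ (i : ℕ) → i < n →
      MinimumDisconnecting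
        E[ pow a i ∙ b , (λ v → v ≡ e ⊎ v ≡ pow a n ⊎ v ≡ pow a (n + i) ∙ b) ]
      × MinimumDisconnecting
        E[ pow a (n + i) ∙ b , (λ v → v ≡ e ⊎ v ≡ pow a n ⊎ v ≡ pow a i ∙ b) ])
theorem5p4 (suc (suc q)) (s≤s (s≤s z≤n)) =
  (3≤degree a≢e , b , three-neighbours⇒degree3 (reflection-neighbours 0)) ,
  λ i _ → isolating-cut-minimum (neighbours-aⁱb i) , isolating-cut-minimum (neighbours-aⁿ⁺ⁱb i)
  where
    open DicyclicPowerGraph q
    open Dicyclic (suc (suc q)) using (b)
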